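{- Fix integers $t,m\ge 1$, let $\mathbf{A},\mathbf{B}\in\mathbb{R}^{n\times n}$ satisfy $\mathbf{A}\cong_{\mathcal{U}_n^t,S_n}\mathbf{B}$, and let $\mathbf{T}\in\mathbb{R}^{m\times m}$ be any matrix. Then $\mathbf{A}\otimes\mathbf{T}\cong_{\mathcal{U}_{nm}^t,\Gamma_{n,m}}\mathbf{B}\otimes\mathbf{T}$.
   Context: $S_N$ is the symmetric group and $\mathbf{P}_\sigma$ the row permutation matrix of $\sigma\in S_N$. For $U\subseteq[N]\times[N]$ and $\mathbf{M}\in\mathbb{R}^{N\times N}$, $\mathbf{M}_U$ agrees with $\mathbf{M}$ on $U$ and is zero elsewhere. A symmetric $U$ ($(i,j)\in U\iff(j,i)\in U$) is viewed as an undirected graph on $[N]$ possibly with self-loops. For a family $\mathcal{U}$ of symmetric subsets of $[N]\times[N]$ and a subgroup $\Gamma\le S_N$, $\mathbf{M}\cong_{\mathcal{U},\Gamma}\mathbf{M}'$ means: for every $U\in\mathcal{U}$ there is a bijection $\psi_U:\Gamma\to\Gamma$ with $(\mathbf{P}_\sigma\mathbf{M}\mathbf{P}_\sigma^\top)_U=(\mathbf{P}_{\psi_U(\sigma)}\mathbf{M}'\mathbf{P}_{\psi_U(\sigma)}^\top)_U$ for all $\sigma\in\Gamma$. $\mathcal{U}_N^t$ is the set of all symmetric $U\subseteq[N]\times[N]$ whose graph, after removing self-loops, has no $t$ pairwise vertex-disjoint edges. Indexing $[nm]$ by pairs $(i,j)\in[n]\times[m]$ consistently with the Kronecker product, $\Gamma_{n,m}=\{\sigma\in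 S_{nm}:\sigma(i,j)=(\pi(i),j)\text{ for some }\pi\in S_n\}$. -}

module Defs where

open import Level using (Level; _⊔_)
open import Data.Nat using (ℕ; _*_)
open import Data.Fin using (Fin; combine; remQuot)
open import Data.Fin.Permutation using (Permutation′; _⟨$⟩ʳ_; _⟨$⟩ˡ_)
open import Data.Bool using (Bool; true)
open import Data.Product using (Σ; ∃; _×_; _,_; proj₁; proj₂)
open import Data.Unit using (⊤)
open import Relation.Nullary using (¬_)
open import Relation.Binary.PropositionalEquality using (_≡_; _≢_)
open import Algebra.Bundles using (CommutativeRing)

Mat : ∀ {a} → Set a → ℕ → Set a
Mat A N = Fin N → Fin N → A

-- P_σ M P_σᵀ : with P_σ the row permutation matrix (P_σ e_j = e_{σ j}),
-- (P_σ M P_σᵀ)_{ij} = M_{σ⁻¹ i, σ⁻¹ j}.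
conjP : ∀ {a} {A : Set a} {N : ℕ} → Permutation′ N → Mat A N → Mat A N
conjP σ M i j = M (σ ⟨$⟩ˡ i) (σ ⟨$⟩ˡ j)

Rel2 : ℕ → Set
Rel2 N = Fin N → Fin N → Bool

Symmetric : ∀ {N} → Rel2 N → Set
Symmetric U = ∀ i j → U i j ≡ U j i

Matching : ∀ {N} → Rel2 N → ℕ → Set
Matching {N} U t =
  Σ (Fin t → Fin N × Fin N) λ e →
    (∀ k → U (proj₁ (e k)) (proj₂ (e k)) ≡ true × proj₁ (e k) ≢ proj₂ (e k))
    × (∀ k k' → k ≢ k' →
         proj₁ (e k) ≢ proj₁ (e k') × proj₁ (e k) ≢ proj₂ (e k')
         × proj₂ (e k) ≢ proj₁ (e k') × proj₂ (e k) ≢ proj₂ (e k'))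

InU : (N t : ℕ) → Rel2 N → Set
InU N t U = Symmetric U × ¬ Matching U t

-- (M)_U = (M')_U, entrywise (both are zero outside U), w.r.t. an entry equality.
EqOn : ∀ {a ℓ} {A : Set a} (_≈_ : A → A → Set ℓ) {N} → Rel2 N → Mat A N → Mat A N → Set ℓ
EqOn _≈_ U M M' = ∀ i j → U i j ≡ true → M i j ≈ M' i j

-- A subgroup Γ ≤ S_N is given by a membership predicate; its elements form the subtype.
Elem : ∀ {N} → (Permutation′ N → Set) → Set
Elem {N} Γ = Σ (Permutation′ N) Γ

PermEq : (N : ℕ) → Permutation′ N → Permutation′ N → Set
PermEq N σ τ = ∀ i → σ ⟨$⟩ʳ i ≡ τ ⟨$⟩ʳ i

IsBijOn : ∀ {N} (Γ : Permutation′ N → Set) → (Elem Γ → Elem Γ) → Set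
IsBijOn {N} Γ ψ =
    (∀ x y → PermEq N (proj₁ x) (proj₁ y) → PermEq N (proj₁ (ψ x)) (proj₁ (ψ y)))
  × (∀ x y → PermEq N (proj₁ (ψ x)) (proj₁ (ψ y)) → PermEq N (proj₁ x) (proj₁ y))
  × (∀ (y : Elem Γ) → ∃ λ (x : Elem Γ) → PermEq N (proj₁ (ψ x)) (proj₁ y))

Equiv : ∀ {a ℓ : Level} {A : Set a} (_≈_ : A → A → Set ℓ) (N t : ℕ)
        (Γ : Permutation′ N → Set) → Mat A N → Mat A N → Set ℓ
Equiv _≈_ N t Γ M M' =
  ∀ (U : Rel2 N) → InU N t U →
    Σ (Elem Γ → Elem Γ) λ ψ → IsBijOn Γ ψ ×
      (∀ (x : Elem Γ) →
         EqOn _≈_ U (conjP (proj₁ x) M) (conjP (proj₁ (ψ x)) M'))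

SymAll : ∀ {N} → Permutation′ N → Set
SymAll _ = ⊤

-- Γ_{n,m}: permutations σ of [n]×[m] ≅ Fin (n*m) (index (i,j) ↦ i*m+j, as in
-- the Kronecker product) with σ(i,j) = (π(i), j) for some π ∈ S_n.
Gamma : (n m : ℕ) → Permutation′ (n * m) → Set
Gamma n m σ = ∃ λ (π : Permutation′ n) →
  ∀ (i : Fin n) (j : Fin m) → σ ⟨$⟩ʳ combine i j ≡ combine (π ⟨$⟩ʳ i) j

kron : ∀ {a} {A : Set a} (_·_ : A → A → A) {n m : ℕ} → Mat A n → Mat A m → Mat A (n * m)
kron _·_ {n} {m} M T p q with remQuot {n} m p | remQuot {n} m q
... | i , j | k , l = M i k · T j l

module Submission where

-- Index [nm] by block coordinates (i , j) ∈ [n] × [m] via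
-- `combine`.  Every σ ∈ Γ_{n,m} is "π ⊗ id" for a block permutation π ∈ S_n,
-- and conversely every π ∈ S_n lifts to such a σ; two elements of Γ_{n,m}
-- are equal iff their block permutations are (using a point of [m], m ≥ 1).
-- On block coordinates the conjugated Kronecker product factors:
--   (P_σ (A ⊗ T) P_σᵀ)_{(i,j),(k,l)} = (P_π A P_πᵀ)_{ik} · T_{jl}.
-- Given U ∈ 𝒰_{nm}^t, contract it to the block graph Ū on [n] (i ~ k iff
-- some (i,j) ~ (k,l) in U).  Ū is symmetric, and a t-matching of Ū lifts
-- to a t-matching of U (distinct blocks give distinct vertices), so
-- Ū ∈ 𝒰_n^t.  The hypothesis A ≅ B yields a bijection ψ̄ of S_n matching A
-- and B on Ū; lifting it blockwise gives a bijection ψ of Γ_{n,m}, and the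
-- factorisation reduces the required identity on U to the one on Ū.

open import Defs
open import Data.Nat using (ℕ; _≤_; _*_; s≤s)
open import Algebra.Bundles using (CommutativeRing)
open import Data.Fin using (Fin; combine; remQuot; zero)
open import Data.Fin.Properties using (remQuot-combine; combine-remQuot; combine-injectiveˡ; any?)
open import Data.Fin.Permutation
  using (Permutation′; _⟨$⟩ʳ_; _⟨$⟩ˡ_; permutation; inverseˡ; inverseʳ)
open import Data.Bool using (true)
open import Data.Bool.Properties using (_≟_)
open import Data.Product using (∃; _×_; _,_; proj₁; proj₂)
open import Data.Unit using (tt)
open import Relation.Nullary using (Dec; yes; no; does)
open import Relation.Nullary.Decidable using (dec-true; dec-false)
open import Relation.Binary.PropositionalEquality
  using (_≡_; _≢_; sym; trans; cong; cong₂; subst; subst₂; module ≡-Reasoning)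

module Blocks (n m : ℕ) where

  combine-≢ : ∀ {i k : Fin n} (j l : Fin m) → i ≢ k → combine i j ≢ combine k l
  combine-≢ j l i≢k e = i≢k (combine-injectiveˡ _ j _ l e)

  byBlocks : ∀ {p} (P : Fin (n * m) → Set p) → (∀ i j → P (combine i j)) → ∀ r → P r
  byBlocks P h r =
    subst P (combine-remQuot {n} m r) (h (proj₁ (remQuot {n} m r)) (proj₂ (remQuot {n} m r)))

  byBlocks₂ : ∀ {p} (P : Fin (n * m) → Fin (n * m) → Set p) →
              (∀ i j k l → P (combine i j) (combine k l)) → ∀ r s → P r s
  byBlocks₂ P h r s = byBlocks (λ r → P r s) (λ i j → byBlocks (P (combine i j)) (h i j) s) r

  onBlocks : (Fin n → Fin n) → Fin (n * m) → Fin (n * m)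
  onBlocks f r = combine (f (proj₁ (remQuot {n} m r))) (proj₂ (remQuot {n} m r))

  onBlocks-combine : ∀ f i j → onBlocks f (combine i j) ≡ combine (f i) j
  onBlocks-combine f i j =
    cong (λ r → combine (f (proj₁ r)) (proj₂ r)) (remQuot-combine {n} {m} i j)

  onBlocks-inverse : ∀ f g → (∀ i → f (g i) ≡ i) → ∀ r → onBlocks f (onBlocks g r) ≡ r
  onBlocks-inverse f g fg r = begin
      onBlocks f (onBlocks g r)  ≡⟨ onBlocks-combine f (g i) j ⟩
      combine (f (g i)) j        ≡⟨ cong (λ z → combine z j) (fg i) ⟩
      combine i j                ≡⟨ combine-remQuot {n} m r ⟩
      r                          ∎
    where
    open ≡-Reasoning
    i : Fin n
    i = proj₁ (remQuot {n} m r)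
    j : Fin m
    j = proj₂ (remQuot {n} m r)

  liftPerm : Permutation′ n → Permutation′ (n * m)
  liftPerm π = permutation (onBlocks (π ⟨$⟩ʳ_)) (onBlocks (π ⟨$⟩ˡ_))
    (onBlocks-inverse (π ⟨$⟩ʳ_) (π ⟨$⟩ˡ_) (λ _ → inverseʳ π))
    (onBlocks-inverse (π ⟨$⟩ˡ_) (π ⟨$⟩ʳ_) (λ _ → inverseˡ π))

  liftPerm-Γ : ∀ π → Gamma n m (liftPerm π)
  liftPerm-Γ π = π , onBlocks-combine (π ⟨$⟩ʳ_)

  blockPerm : Elem (Gamma n m) → Permutation′ n
  blockPerm (_ , π , _) = π

  Γ-inverse : ∀ (x : Elem (Gamma n m)) i j →
              proj₁ x ⟨$⟩ˡ combine i j ≡ combine (blockPerm x ⟨$⟩ˡ i) j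
  Γ-inverse (σ , π , σ-blocks) i j = begin
      σ ⟨$⟩ˡ combine i j                    ≡⟨ cong (λ z → σ ⟨$⟩ˡ combine z j) (sym (inverseʳ π)) ⟩
      σ ⟨$⟩ˡ combine (π ⟨$⟩ʳ (π ⟨$⟩ˡ i)) j  ≡⟨ cong (σ ⟨$⟩ˡ_) (sym (σ-blocks (π ⟨$⟩ˡ i) j)) ⟩
      σ ⟨$⟩ˡ (σ ⟨$⟩ʳ combine (π ⟨$⟩ˡ i) j)  ≡⟨ inverseˡ σ ⟩
      combine (π ⟨$⟩ˡ i) j                  ∎
    where open ≡-Reasoning

  -- Elements of Γ_{n,m} are equal iff their block permutations are; the
  -- forward direction reads off blocks in a fixed column j₀ ∈ [m].
  Γ-blocksEq : Fin m → ∀ (x y : Elem (Gamma n m)) →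
               PermEq (n * m) (proj₁ x) (proj₁ y) → PermEq n (blockPerm x) (blockPerm y)
  Γ-blocksEq j₀ (σ , π , σ-blocks) (σ' , π' , σ'-blocks) σ≗σ' i =
    combine-injectiveˡ _ j₀ _ j₀
      (trans (sym (σ-blocks i j₀)) (trans (σ≗σ' (combine i j₀)) (σ'-blocks i j₀)))

  Γ-eqFromBlocks : ∀ (x y : Elem (Gamma n m)) →
                   PermEq n (blockPerm x) (blockPerm y) → PermEq (n * m) (proj₁ x) (proj₁ y)
  Γ-eqFromBlocks (σ , π , σ-blocks) (σ' , π' , σ'-blocks) π≗π' r =
    byBlocks (λ r → σ ⟨$⟩ʳ r ≡ σ' ⟨$⟩ʳ r)
      (λ i j → trans (σ-blocks i j)
                 (trans (cong (λ z → combine z j) (π≗π' i)) (sym (σ'-blocks i j))))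
      r

  conjP-kron : ∀ {a} {A : Set a} (_·_ : A → A → A) (M : Mat A n) (T : Mat A m)
               (x : Elem (Gamma n m)) i j k l →
               conjP (proj₁ x) (kron _·_ M T) (combine i j) (combine k l)
                 ≡ (M (blockPerm x ⟨$⟩ˡ i) (blockPerm x ⟨$⟩ˡ k) · T j l)
  conjP-kron _·_ M T x i j k l =
    trans (cong₂ (kron _·_ M T) (Γ-inverse x i j) (Γ-inverse x k l))
          (cong₂ (λ r s → M (proj₁ r) (proj₁ s) · T (proj₂ r) (proj₂ s))
                 (remQuot-combine {n} {m} (blockPerm x ⟨$⟩ˡ i) j)
                 (remQuot-combine {n} {m} (blockPerm x ⟨$⟩ˡ k) l))

  BlockAdjacent : Rel2 (n * m) → Fin n → Fin n → Set
  BlockAdjacent U i k = ∃ λ j → ∃ λ l → U (combine i j) (combine k l) ≡ true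

  blockAdjacent? : ∀ U i k → Dec (BlockAdjacent U i k)
  blockAdjacent? U i k = any? λ j → any? λ l → U (combine i j) (combine k l) ≟ true

  blockGraph : Rel2 (n * m) → Rel2 n
  blockGraph U i k = does (blockAdjacent? U i k)

  blockGraph-intro : ∀ U {i k} j l → U (combine i j) (combine k l) ≡ true →
                     blockGraph U i k ≡ true
  blockGraph-intro U j l u = dec-true (blockAdjacent? U _ _) (j , l , u)

  blockGraph-elim : ∀ U i k → blockGraph U i k ≡ true → BlockAdjacent U i k
  blockGraph-elim U i k e with blockAdjacent? U i k
  ... | yes adj = adj

  blockGraph-symmetric : ∀ U → Symmetric U → Symmetric (blockGraph U)
  blockGraph-symmetric U U-sym i k with blockAdjacent? U k i
  ... | yes (l , j , u) = blockGraph-intro U j l (trans (U-sym _ _) u)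
  ... | no ¬adj = dec-false (blockAdjacent? U i k)
                    λ (j , l , u) → ¬adj (l , j , trans (U-sym _ _) u)

  -- A t-matching of the block graph lifts to a t-matching of U: pick a
  -- witness edge for each block edge; endpoints in distinct blocks differ.
  blockGraph-matching : ∀ U t → Matching (blockGraph U) t → Matching U t
  blockGraph-matching U t (e , edges , disjoint) = e' , edges' , disjoint'
    where
    witness : ∀ s → BlockAdjacent U (proj₁ (e s)) (proj₂ (e s))
    witness s = blockGraph-elim U _ _ (proj₁ (edges s))
    e' : Fin t → Fin (n * m) × Fin (n * m)
    e' s = combine (proj₁ (e s)) (proj₁ (witness s)) ,
           combine (proj₂ (e s)) (proj₁ (proj₂ (witness s)))
    edges' : ∀ s → U (proj₁ (e' s)) (proj₂ (e' s)) ≡ true × proj₁ (e' s) ≢ proj₂ (e' s)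
    edges' s = proj₂ (proj₂ (witness s)) , combine-≢ _ _ (proj₂ (edges s))
    disjoint' : ∀ s s' → s ≢ s' →
                proj₁ (e' s) ≢ proj₁ (e' s') × proj₁ (e' s) ≢ proj₂ (e' s')
                × proj₂ (e' s) ≢ proj₁ (e' s') × proj₂ (e' s) ≢ proj₂ (e' s')
    disjoint' s s' s≢s' with disjoint s s' s≢s'
    ... | d₁ , d₂ , d₃ , d₄ =
      combine-≢ _ _ d₁ , combine-≢ _ _ d₂ , combine-≢ _ _ d₃ , combine-≢ _ _ d₄

  blockGraph-InU : ∀ t U → InU (n * m) t U → InU n t (blockGraph U)
  blockGraph-InU t U (U-sym , noMatching) =
    blockGraph-symmetric U U-sym , λ mt → noMatching (blockGraph-matching U t mt)

  blockElem : Elem (Gamma n m) → Elem {n} SymAll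
  blockElem x = blockPerm x , tt

  liftElem : Permutation′ n → Elem (Gamma n m)
  liftElem π = liftPerm π , liftPerm-Γ π

  liftMap : (Elem {n} SymAll → Elem SymAll) → Elem (Gamma n m) → Elem (Gamma n m)
  liftMap ψ̄ x = liftElem (proj₁ (ψ̄ (blockElem x)))

  liftMap-bijective : Fin m → ∀ ψ̄ → IsBijOn SymAll ψ̄ → IsBijOn (Gamma n m) (liftMap ψ̄)
  liftMap-bijective j₀ ψ̄ (respects , injective , surjective) =
    respects' , injective' , surjective'
    where
    respects' : ∀ x y → PermEq (n * m) (proj₁ x) (proj₁ y) →
                PermEq (n * m) (proj₁ (liftMap ψ̄ x)) (proj₁ (liftMap ψ̄ y))
    respects' x y x≗y = Γ-eqFromBlocks (liftMap ψ̄ x) (liftMap ψ̄ y)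
      (respects (blockElem x) (blockElem y) (Γ-blocksEq j₀ x y x≗y))
    injective' : ∀ x y → PermEq (n * m) (proj₁ (liftMap ψ̄ x)) (proj₁ (liftMap ψ̄ y)) →
                 PermEq (n * m) (proj₁ x) (proj₁ y)
    injective' x y ψx≗ψy = Γ-eqFromBlocks x y
      (injective (blockElem x) (blockElem y) (Γ-blocksEq j₀ (liftMap ψ̄ x) (liftMap ψ̄ y) ψx≗ψy))
    surjective' : ∀ y → ∃ λ x → PermEq (n * m) (proj₁ (liftMap ψ̄ x)) (proj₁ y)
    surjective' y with surjective (blockElem y)
    ... | (π , _) , ψ̄π≗y = liftElem π , Γ-eqFromBlocks (liftMap ψ̄ (liftElem π)) y ψ̄π≗y

pointOf : ∀ {m} → 1 ≤ m → Fin m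
pointOf (s≤s _) = zero

mainTheorem17 : ∀ {c ℓ} (R : CommutativeRing c ℓ) (t m n : ℕ) → 1 ≤ t → 1 ≤ m →
    (A B : Mat (CommutativeRing.Carrier R) n) →
    Equiv (CommutativeRing._≈_ R) n t SymAll A B →
    (T : Mat (CommutativeRing.Carrier R) m) →
    Equiv (CommutativeRing._≈_ R) (n * m) t (Gamma n m)
      (kron (CommutativeRing._*_ R) A T) (kron (CommutativeRing._*_ R) B T)
-- Apply the hypothesis to the block graph Ū ∈ 𝒰_n^t of U, lift the resulting
-- bijection ψ̄ of S_n to Γ_{n,m}, and compare both sides entrywise on blocks.
mainTheorem17 R t m n _ m≥1 A B A≅B T U U∈𝒰
  with A≅B (Blocks.blockGraph n m U) (Blocks.blockGraph-InU n m t U U∈𝒰)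
... | ψ̄ , ψ̄-bijective , A≈B-on-Ū =
  liftMap ψ̄ , liftMap-bijective (pointOf m≥1) ψ̄ ψ̄-bijective , agreeOnU
  where
  open Blocks n m
  open CommutativeRing R using (_≈_; *-cong) renaming (_*_ to _·_; refl to ≈-refl)
  -- On block coordinates both sides factor, and the A/B factors agree on Ū.
  agreeOnU : ∀ x → EqOn _≈_ U (conjP (proj₁ x) (kron _·_ A T))
                              (conjP (proj₁ (liftMap ψ̄ x)) (kron _·_ B T))
  agreeOnU x = byBlocks₂ _ λ i j k l u →
    subst₂ _≈_ (sym (conjP-kron _·_ A T x i j k l))
               (sym (conjP-kron _·_ B T (liftMap ψ̄ x) i j k l))
      (*-cong (A≈B-on-Ū (blockElem x) i k (blockGraph-intro U j l u)) ≈-refl)
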